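{- Let $H$ be a connected $k$-uniform hypergraph and $R\ge1$, and suppose there is a set $U$ of vertices with $|U|\ge2$ such that $\mathrm{dist}(u,v)>R$ for all distinct $u,v\in U$. Then $H$ has at least $\frac{|U|R}{2}$ hyperedges.
   Context: A path is a sequence of hyperedges $C_1,\ldots,C_\ell$ with $C_i\cap C_{i-1}\neq\emptyset$ for $2\le i\le\ell$ and $C_i\cap C_j=\emptyset$ for $|i-j|>1$; it joins $u\in C_1$ to $v\in C_\ell$. $\mathrm{dist}(u,v)$ is the minimum number of hyperedges in a path joining $u$ and $v$. Connected means every two distinct vertices are joined by a path. -}

module Defs where

open import Data.Nat using (ℕ; zero; suc; _<_)
open import Data.Fin using (Fin; toℕ; fromℕ) renaming (zero to fzero)
open import Data.Fin.Subset using (Subset; _∈_; _∩_; ∣_∣; Nonempty; Empty)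
open import Data.List using (List; length)
import Data.List.Membership.Propositional as LM
open import Data.List.Relation.Unary.All using (All)
open import Data.List.Relation.Unary.Unique.Propositional using (Unique)
open import Relation.Binary.PropositionalEquality using (_≡_; _≢_)
open import Data.Product using (Σ; _×_)

record Hypergraph (n : ℕ) : Set where
  field
    edges  : List (Subset n)
    unique : Unique edges

open Hypergraph public

numEdges : ∀ {n} → Hypergraph n → ℕ
numEdges H = length (edges H)

Uniform : ∀ {n} → ℕ → Hypergraph n → Set
Uniform k H = All (λ e → ∣ e ∣ ≡ k) (edges H)

record Path {n : ℕ} (H : Hypergraph n) (u v : Fin n) : Set where
  field
    m        : ℕ
    C        : Fin (suc m) → Subset n
    isEdge   : ∀ i → LM._∈_ (C i) (edges H)
    adjacent : ∀ i j → toℕ j ≡ suc (toℕ i) → Nonempty (C i ∩ C j)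
    farApart : ∀ i j → suc (toℕ i) < toℕ j → Empty (C i ∩ C j)
    start    : u ∈ C fzero
    end      : v ∈ C (fromℕ m)

open Path public

len : ∀ {n} {H : Hypergraph n} {u v} → Path H u v → ℕ
len P = suc (m P)

Connected : ∀ {n} → Hypergraph n → Set
Connected {n} H = ∀ (u v : Fin n) → u ≢ v → Path H u v

DistGreater : ∀ {n} → Hypergraph n → Fin n → Fin n → ℕ → Set
DistGreater H u v R = (P : Path H u v) → R < len P

module Submission where

-- Let r = ⌈R/2⌉ and, for u ∈ U, let B u be the set of hyperedges reachable from u
-- by a walk of at most r hyperedges. Walks shorten to paths, so if B u and B v
-- shared a hyperedge, gluing two such paths would join u and v by a path of at
-- most 2r - 1 ≤ R hyperedges; hence the balls are pairwise disjoint. A ball that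
-- stops growing before radius r would be closed under adjacency and, H being
-- connected, would contain a whole path from u to another point of U, again too
-- short; so |B u| ≥ r. Summing, |U| r ≤ |E| and |U| R ≤ 2 |U| r ≤ 2 |E|.

open import Data.Bool using (Bool; true; false; T; _∨_; _∧_)
open import Data.Bool.ListAction using (any)
open import Data.Bool.Properties using (T-∨; T-∧)
open import Data.Empty using (⊥; ⊥-elim)
open import Data.Fin using (Fin; toℕ; fromℕ; fromℕ<; _≟_) renaming (zero to fzero; suc to fsuc)
open import Data.Fin.Properties as Fin using (any?; toℕ-fromℕ; toℕ-fromℕ<; toℕ≤pred[n]; fromℕ<-toℕ; toℕ<n)
open import Data.Fin.Subset using (Subset; _∈_; ∣_∣; _∩_; Nonempty; Empty; inside; outside; ⁅_⁆; _⊆_)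
open import Data.Fin.Subset.Properties using (_∈?_; nonempty?; x∈⁅x⁆; ∣⁅x⁆∣≡1; p⊆q⇒∣p∣≤∣q∣; ∩-comm)
open import Data.List using (List; []; _∷_; length)
open import Data.List.Membership.Propositional using (find; lose) renaming (_∈_ to _∈ₗ_)
open import Data.List.Relation.Unary.Any using (here; there)
open import Data.List.Relation.Unary.Any.Properties using (any⁺; any⁻)
open import Data.Nat using (ℕ; zero; suc; _+_; _*_; _≤_; _<_; z≤n; s≤s; _≤?_; ⌈_/2⌉; ⌊_/2⌋)
open import Data.Nat.Properties hiding (_≟_)
open import Algebra.Properties.CommutativeMonoid.Sum +-0-commutativeMonoid
  using (sum; sum-cong-≗; sum-replicate-zero; ∑-distrib-+)
open import Data.Product using (Σ-syntax; ∃-syntax; _×_; _,_)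
open import Data.Sum using (_⊎_; inj₁; inj₂)
open import Data.Unit using (tt)
open import Data.Vec using ([]; _∷_) renaming (here to vhere; there to vthere)
open import Function using (_∘_; Equivalence)
open import Relation.Binary.PropositionalEquality using (_≡_; _≢_; refl; sym; trans; cong; subst)
open import Relation.Nullary using (Dec; yes; no; ¬_; contradiction)
open import Relation.Nullary.Decidable using (_×-dec_; ¬?; isYes; toWitness; fromWitness)

open import Defs

indicator : Bool → ℕ
indicator false = 0
indicator true  = 1

indicator-mono : ∀ {a b} → (T a → T b) → indicator a ≤ indicator b
indicator-mono {false}         _   = z≤n
indicator-mono {true} {true}   _   = ≤-refl
indicator-mono {true} {false} a⇒b = ⊥-elim (a⇒b tt)

indicator-≤⇒T : ∀ {a b} → indicator a ≤ indicator b → T a → T b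
indicator-≤⇒T {true} {true} _ _ = tt

count : ∀ {a} {A : Set a} → (A → Bool) → List A → ℕ
count p []       = 0
count p (x ∷ xs) = indicator (p x) + count p xs

module _ {a} {A : Set a} where

  _⊆[_]_ : (A → Bool) → List A → (A → Bool) → Set a
  p ⊆[ xs ] q = ∀ {x} → x ∈ₗ xs → T (p x) → T (q x)

  count-mono : ∀ {p q} xs → p ⊆[ xs ] q → count p xs ≤ count q xs
  count-mono []       _   = z≤n
  count-mono (x ∷ xs) p⊆q = +-mono-≤ (indicator-mono (p⊆q (here refl))) (count-mono xs (p⊆q ∘ there))

  count-≤⇒⊇ : ∀ {p q} xs → p ⊆[ xs ] q → count q xs ≤ count p xs → q ⊆[ xs ] p
  count-≤⇒⊇ {p} {q} (x ∷ xs) p⊆q q≤p (here refl) =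
    indicator-≤⇒T (+-cancelʳ-≤ (count q xs) _ _
      (≤-trans q≤p (+-monoʳ-≤ (indicator (p x)) (count-mono xs (p⊆q ∘ there)))))
  count-≤⇒⊇ {p} {q} (x ∷ xs) p⊆q q≤p (there y∈xs) =
    count-≤⇒⊇ xs (p⊆q ∘ there)
      (+-cancelˡ-≤ (indicator (q x)) _ _
        (≤-trans q≤p (+-monoˡ-≤ (count p xs) (indicator-mono (p⊆q (here refl))))))
      y∈xs

∑-indicator≤1 : ∀ {n} (g : Fin n → Bool) → (∀ i j → T (g i) → T (g j) → i ≡ j) →
                sum (indicator ∘ g) ≤ 1
∑-indicator≤1 {zero}  g _      = z≤n
∑-indicator≤1 {suc n} g atMost1 with g fzero in g₀
... | false = ∑-indicator≤1 (g ∘ fsuc) (λ i j gi gj → Fin.suc-injective (atMost1 _ _ gi gj))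
... | true  = s≤s (≤-reflexive (trans (sum-cong-≗ others-false) (sum-replicate-zero n)))
  where
  others-false : ∀ i → indicator (g (fsuc i)) ≡ 0
  others-false i with g (fsuc i) in gᵢ
  ... | false = refl
  ... | true  with () ← atMost1 fzero (fsuc i) (subst T (sym g₀) tt) (subst T (sym gᵢ) tt)

∑-count≤length : ∀ {n a} {A : Set a} (F : Fin n → A → Bool) xs →
                 (∀ {x} → x ∈ₗ xs → ∀ i j → T (F i x) → T (F j x) → i ≡ j) →
                 sum (λ i → count (F i) xs) ≤ length xs
∑-count≤length {n} F [] _ = ≤-reflexive (sum-replicate-zero n)
∑-count≤length F (x ∷ xs) atMost1 = begin
  sum (λ i → indicator (F i x) + count (F i) xs)
    ≡⟨ ∑-distrib-+ (λ i → indicator (F i x)) (λ i → count (F i) xs) ⟩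
  sum (λ i → indicator (F i x)) + sum (λ i → count (F i) xs)
    ≤⟨ +-mono-≤ (∑-indicator≤1 (λ i → F i x) (atMost1 (here refl))) (∑-count≤length F xs (atMost1 ∘ there)) ⟩
  1 + length xs
    ∎
  where open ≤-Reasoning

∣p∣*r≤∑ : ∀ {n} (p : Subset n) (f : Fin n → ℕ) r → (∀ {i} → i ∈ p → r ≤ f i) → ∣ p ∣ * r ≤ sum f
∣p∣*r≤∑ []            f r _     = z≤n
∣p∣*r≤∑ (inside ∷ p)  f r bound = +-mono-≤ (bound vhere) (∣p∣*r≤∑ p (f ∘ fsuc) r (bound ∘ vthere))
∣p∣*r≤∑ (outside ∷ p) f r bound = ≤-trans (∣p∣*r≤∑ p (f ∘ fsuc) r (bound ∘ vthere)) (m≤n+m _ (f fzero))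

n≤⌈n/2⌉+⌈n/2⌉ : ∀ n → n ≤ ⌈ n /2⌉ + ⌈ n /2⌉
n≤⌈n/2⌉+⌈n/2⌉ n = begin
  n                       ≡⟨ sym (⌊n/2⌋+⌈n/2⌉≡n n) ⟩
  ⌊ n /2⌋ + ⌈ n /2⌉       ≤⟨ +-monoˡ-≤ ⌈ n /2⌉ (⌊n/2⌋≤⌈n/2⌉ n) ⟩
  ⌈ n /2⌉ + ⌈ n /2⌉       ∎
  where open ≤-Reasoning

⌈n/2⌉+⌈n/2⌉≤1+n : ∀ n → ⌈ n /2⌉ + ⌈ n /2⌉ ≤ suc n
⌈n/2⌉+⌈n/2⌉≤1+n n = begin
  ⌊ suc n /2⌋ + ⌊ suc n /2⌋ ≤⟨ +-monoʳ-≤ ⌊ suc n /2⌋ (⌊n/2⌋≤⌈n/2⌉ (suc n)) ⟩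
  ⌊ suc n /2⌋ + ⌈ suc n /2⌉ ≡⟨ ⌊n/2⌋+⌈n/2⌉≡n (suc n) ⟩
  suc n                     ∎
  where open ≤-Reasoning

∃-other-member : ∀ {n} (p : Subset n) (u : Fin n) → 2 ≤ ∣ p ∣ → ∃[ v ] (v ∈ p × v ≢ u)
∃-other-member p u 2≤∣p∣ with any? (λ v → (v ∈? p) ×-dec ¬? (v ≟ u))
... | yes other = other
... | no ¬other =
  contradiction (≤-trans 2≤∣p∣ (≤-trans (p⊆q⇒∣p∣≤∣q∣ p⊆⁅u⁆) (≤-reflexive (∣⁅x⁆∣≡1 u)))) (<-irrefl refl)
  where
  p⊆⁅u⁆ : p ⊆ ⁅ u ⁆
  p⊆⁅u⁆ {x} x∈p with x ≟ u
  ... | yes refl = x∈⁅x⁆ x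
  ... | no x≢u   = contradiction (x , x∈p , x≢u) ¬other

module _ {p} {P : ℕ → Set p} (P? : ∀ i → Dec (P i)) where

  least-witness-from : ∀ k d → (∀ {j} → j < k → ¬ P j) → P (d + k) →
               ∃[ i ] (i ≤ d + k × P i × (∀ {j} → j < i → ¬ P j))
  least-witness-from k zero    below Pk = k , ≤-refl , Pk , below
  least-witness-from k (suc d) below Pd+k with P? k
  ... | yes Pk = k , m≤n+m k (suc d) , Pk , below
  ... | no ¬Pk = let i , i≤ , Pi , minimal = least-witness-from (suc k) d below′ (subst P (sym (+-suc d k)) Pd+k)
                 in i , ≤-trans i≤ (≤-reflexive (+-suc d k)) , Pi , minimal
    where
    below′ : ∀ {j} → j < suc k → ¬ P j
    below′ j<1+k with m<1+n⇒m<n∨m≡n j<1+k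
    ... | inj₁ j<k  = below j<k
    ... | inj₂ refl = ¬Pk

  least-witness : ∀ {m} → P m → ∃[ i ] (i ≤ m × P i × (∀ {j} → j < i → ¬ P j))
  least-witness {m} Pm = let i , i≤ , rest = least-witness-from 0 m (λ ()) (subst P (sym (+-identityʳ m)) Pm)
                 in i , ≤-trans i≤ (≤-reflexive (+-identityʳ m)) , rest

splice : ∀ {a} {A : Set a} → ℕ → (ℕ → A) → A → ℕ → A
splice i f y k with k ≤? i
... | yes _ = f k
... | no  _ = y

splice-≤ : ∀ {a} {A : Set a} i (f : ℕ → A) y {k} → k ≤ i → splice i f y k ≡ f k
splice-≤ i f y {k} k≤i with k ≤? i
... | yes _   = refl
... | no  k≰i = contradiction k≤i k≰i

splice-> : ∀ {a} {A : Set a} i (f : ℕ → A) y {k} → i < k → splice i f y k ≡ y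
splice-> i f y {k} i<k with k ≤? i
... | yes k≤i = contradiction k≤i (<⇒≱ i<k)
... | no  _   = refl

module _ {n} (H : Hypergraph n) where

  -- A Path H u v with edges indexed by ℕ (values past `last` are irrelevant),
  -- recording its final edge instead of its end vertex.
  record PathTo (u : Fin n) (e : Subset n) : Set where
    field
      last      : ℕ
      edge      : ℕ → Subset n
      edge∈     : ∀ {i} → i ≤ last → edge i ∈ₗ edges H
      meetsNext : ∀ {i} → suc i ≤ last → Nonempty (edge i ∩ edge (suc i))
      apart     : ∀ {i j} → suc i < j → j ≤ last → Empty (edge i ∩ edge j)
      starts    : u ∈ edge 0
      ends      : edge last ≡ e

  open PathTo

  singleton : ∀ {u e} → u ∈ e → e ∈ₗ edges H → PathTo u e
  singleton {e = e} u∈e e∈H = record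
    { last = 0 ; edge = λ _ → e ; edge∈ = λ _ → e∈H ; meetsNext = λ ()
    ; apart = λ { {j = zero} () ; {j = suc _} _ () } ; starts = u∈e ; ends = refl }

  toPath : ∀ {u v e} → PathTo u e → v ∈ e → Path H u v
  toPath {v = v} P v∈e = record
    { m        = last P
    ; C        = edge P ∘ toℕ
    ; isEdge   = λ i → edge∈ P (toℕ≤pred[n] i)
    ; adjacent = λ i j j≡1+i → subst (λ k → Nonempty (edge P (toℕ i) ∩ edge P k)) (sym j≡1+i)
                   (meetsNext P (subst (_≤ last P) j≡1+i (toℕ≤pred[n] j)))
    ; farApart = λ i j i+1<j → apart P i+1<j (toℕ≤pred[n] j)
    ; start    = starts P
    ; end      = subst (v ∈_) (sym (trans (cong (edge P) (toℕ-fromℕ (last P))) (ends P))) v∈e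
    }

  -- Cut P at its first edge meeting D and append D: minimality of the cut
  -- keeps D disjoint from all earlier edges, so the result is again a path.
  extend : ∀ {u e D} (P : PathTo u e) → D ∈ₗ edges H → Nonempty (e ∩ D) →
           Σ[ Q ∈ PathTo u D ] last Q ≤ suc (last P)
  extend {u} {e} {D} P D∈H e∩D
    with least-witness (λ k → nonempty? (edge P k ∩ D)) (subst (λ c → Nonempty (c ∩ D)) (sym (ends P)) e∩D)
  ... | i , i≤last , Pᵢ∩D , minimal = Q , s≤s i≤last
    where
    Q : PathTo u D
    Q = record
      { last = suc i ; edge = splice i (edge P) D ; edge∈ = edge∈′ ; meetsNext = meetsNext′ ; apart = apart′
      ; starts = subst (u ∈_) (sym (splice-≤ i (edge P) D z≤n)) (starts P) ; ends = splice-> i (edge P) D ≤-refl }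
      where
      edge∈′ : ∀ {k} → k ≤ suc i → splice i (edge P) D k ∈ₗ edges H
      edge∈′ {k} _ with k ≤? i
      ... | yes k≤i = edge∈ P (≤-trans k≤i i≤last)
      ... | no  _   = D∈H

      meetsNext′ : ∀ {k} → suc k ≤ suc i → Nonempty (splice i (edge P) D k ∩ splice i (edge P) D (suc k))
      meetsNext′ {k} (s≤s k≤i) rewrite splice-≤ i (edge P) D k≤i with suc k ≤? i
      ... | yes 1+k≤i = meetsNext P (≤-trans 1+k≤i i≤last)
      ... | no  1+k≰i rewrite ≤-antisym k≤i (≤-pred (≰⇒> 1+k≰i)) = Pᵢ∩D

      apart′ : ∀ {k j} → suc k < j → j ≤ suc i → Empty (splice i (edge P) D k ∩ splice i (edge P) D j)
      apart′ {k} {j} 1+k<j j≤1+i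
        rewrite splice-≤ i (edge P) D (<⇒≤ (≤-pred (≤-trans 1+k<j j≤1+i))) with j ≤? i
      ... | yes j≤i = apart P 1+k<j (≤-trans j≤i i≤last)
      ... | no  _   = minimal (≤-pred (≤-trans 1+k<j j≤1+i))

  retarget : ∀ {u e e′} → PathTo u e → e ≡ e′ → PathTo u e′
  retarget P e≡e′ = record
    { last = last P ; edge = edge P ; edge∈ = edge∈ P ; meetsNext = meetsNext P ; apart = apart P
    ; starts = starts P ; ends = trans (ends P) e≡e′ }

  -- Walk back along Q, extending P by one edge of Q at a time.
  joinFrom : ∀ {u v e} (P : PathTo u e) (Q : PathTo v e) d i → d + i ≡ last Q →
             Σ[ P′ ∈ PathTo u (edge Q i) ] last P′ + i ≤ last P + last Q
  joinFrom P Q zero i i≡last =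
    retarget P (sym (trans (cong (edge Q) i≡last) (ends Q))) , +-monoʳ-≤ (last P) (≤-reflexive i≡last)
  joinFrom P Q (suc d) i 1+d+i≡last with joinFrom P Q d (suc i) (trans (+-suc d i) 1+d+i≡last)
  ... | P′ , bound with extend P′ (edge∈ Q (≤-trans (m≤n+m i (suc d)) i≤last)) Qᵢ₊₁∩Qᵢ
    where
    i≤last : suc d + i ≤ last Q
    i≤last = ≤-reflexive 1+d+i≡last
    Qᵢ₊₁∩Qᵢ : Nonempty (edge Q (suc i) ∩ edge Q i)
    Qᵢ₊₁∩Qᵢ = subst Nonempty (∩-comm (edge Q i) _)
      (meetsNext Q (≤-trans (s≤s (m≤n+m i d)) i≤last))
  ... | P″ , step = P″ , (begin
    last P″ + i         ≤⟨ +-monoˡ-≤ i step ⟩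
    suc (last P′ + i)   ≡⟨ sym (+-suc (last P′) i) ⟩
    last P′ + suc i     ≤⟨ bound ⟩
    last P + last Q     ∎)
    where open ≤-Reasoning

  join : ∀ {u v e} (P : PathTo u e) (Q : PathTo v e) → Σ[ W ∈ Path H u v ] len W ≤ suc (last P + last Q)
  join P Q with joinFrom P Q (last Q) 0 (+-identityʳ (last Q))
  ... | P′ , bound = toPath P′ (starts Q) , s≤s (≤-trans (≤-reflexive (sym (+-identityʳ (last P′)))) bound)

  -- ball u t e holds iff some walk of at most t edges, each meeting the next,
  -- leads from u to e; it is Boolean so that balls can be counted.
  ball : Fin n → ℕ → Subset n → Bool
  ball u zero    e = false
  ball u (suc t) e = isYes (u ∈? e) ∨ any (λ f → ball u t f ∧ isYes (nonempty? (f ∩ e))) (edges H)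

  ball-start : ∀ {u} t {e} → u ∈ e → T (ball u (suc t) e)
  ball-start {u} t {e} u∈e = Equivalence.from (T-∨ {isYes (u ∈? e)}) (inj₁ (fromWitness u∈e))

  ball-step : ∀ {u} t {f e} → f ∈ₗ edges H → T (ball u t f) → Nonempty (f ∩ e) → T (ball u (suc t) e)
  ball-step {u} t {f} {e} f∈H f∈ball f∩e = Equivalence.from (T-∨ {isYes (u ∈? e)}) (inj₂
    (any⁺ (λ g → ball u t g ∧ isYes (nonempty? (g ∩ e)))
      (lose f∈H (Equivalence.from T-∧ (f∈ball , fromWitness f∩e)))))

  ball-suc⁻ : ∀ {u} t {e} → T (ball u (suc t) e) →
              u ∈ e ⊎ ∃[ f ] (f ∈ₗ edges H × T (ball u t f) × Nonempty (f ∩ e))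
  ball-suc⁻ {u} t {e} e∈ball with Equivalence.to T-∨ e∈ball
  ... | inj₁ u∈e = inj₁ (toWitness u∈e)
  ... | inj₂ viaF with find (any⁻ (λ f → ball u t f ∧ isYes (nonempty? (f ∩ e))) (edges H) viaF)
  ... | f , f∈H , f∈ball∧f∩e with Equivalence.to T-∧ f∈ball∧f∩e
  ... | f∈ball , f∩e = inj₂ (f , f∈H , f∈ball , toWitness f∩e)

  ball-mono : ∀ {u} t {e} → T (ball u t e) → T (ball u (suc t) e)
  ball-mono (suc t) e∈ball with ball-suc⁻ t e∈ball
  ... | inj₁ u∈e                    = ball-start (suc t) u∈e
  ... | inj₂ (f , f∈H , f∈ball , f∩e) = ball-step (suc t) f∈H (ball-mono t f∈ball) f∩e

  -- `extend` shortcuts a walk into a path that is no longer.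
  ball-path : ∀ {u} t {e} → e ∈ₗ edges H → T (ball u t e) → Σ[ P ∈ PathTo u e ] suc (last P) ≤ t
  ball-path (suc t) e∈H e∈ball with ball-suc⁻ t e∈ball
  ... | inj₁ u∈e = singleton u∈e e∈H , s≤s z≤n
  ... | inj₂ (f , f∈H , f∈ball , f∩e) with ball-path t f∈H f∈ball
  ... | P , |P|≤t with extend P e∈H f∩e
  ... | Q , |Q|≤|P|+1 = Q , s≤s (≤-trans |Q|≤|P|+1 |P|≤t)

  balls-disjoint : ∀ {u v R r e} → r + r ≤ suc R → DistGreater H u v R →
                   e ∈ₗ edges H → T (ball u r e) → T (ball v r e) → ⊥
  balls-disjoint {R = R} {r} 2r≤1+R far e∈H e∈ballᵤ e∈ballᵥ
    with ball-path r e∈H e∈ballᵤ | ball-path r e∈H e∈ballᵥ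
  ... | P , |P|≤r | Q , |Q|≤r with join P Q
  ... | W , |W|≤ = <-irrefl refl (begin-strict
    len W                       ≤⟨ |W|≤ ⟩
    suc (last P + last Q)       <⟨ s≤s (≤-reflexive (sym (+-suc (last P) (last Q)))) ⟩
    suc (last P) + suc (last Q) ≤⟨ +-mono-≤ |P|≤r |Q|≤r ⟩
    r + r                       ≤⟨ 2r≤1+R ⟩
    suc R                       ≤⟨ far W ⟩
    len W                       ∎)
    where open ≤-Reasoning

  stable-ball-covers-path : ∀ {u v} t → ball u (suc t) ⊆[ edges H ] ball u t →
                            (W : Path H u v) → ∀ i → T (ball u t (C W i))
  stable-ball-covers-path {u} t stable W i =
    subst (λ j → T (ball u t (C W j))) (fromℕ<-toℕ i (toℕ<n i)) (covers (toℕ i) (toℕ<n i))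
    where
    covers : ∀ k (k<len : k < len W) → T (ball u t (C W (fromℕ< k<len)))
    covers zero    _     = stable (isEdge W fzero) (ball-start t (start W))
    covers (suc k) k+1<len =
      stable (isEdge W k+1ᶠ) (ball-step t (isEdge W kᶠ) (covers k k<len) (adjacent W kᶠ k+1ᶠ adj))
      where
      k<len : k < len W
      k<len = <-trans (n<1+n k) k+1<len
      kᶠ k+1ᶠ : Fin (len W)
      kᶠ = fromℕ< k<len
      k+1ᶠ = fromℕ< k+1<len
      adj : toℕ k+1ᶠ ≡ suc (toℕ kᶠ)
      adj = trans (toℕ-fromℕ< k+1<len) (cong suc (sym (toℕ-fromℕ< k<len)))

  stable-ball⇒short-path : ∀ {u v t} → ball u (suc t) ⊆[ edges H ] ball u t →
                           Path H u v → Σ[ W ∈ Path H u v ] len W ≤ t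
  stable-ball⇒short-path {t = t} stable W
    with ball-path t (isEdge W (fromℕ (m W))) (stable-ball-covers-path t stable W (fromℕ (m W)))
  ... | P , |P|≤t = toPath P (end W) , |P|≤t

  ball-growth : ∀ {u v R} → Path H u v → DistGreater H u v R →
                ∀ t → t ≤ suc R → t ≤ count (ball u t) (edges H)
  ball-growth W far zero    _ = z≤n
  ball-growth {u} W far (suc t) 1+t≤1+R
    with count (ball u (suc t)) (edges H) ≤? count (ball u t) (edges H)
  ... | yes no-growth with stable-ball⇒short-path (count-≤⇒⊇ (edges H) (λ _ → ball-mono t) no-growth) W
  ...   | W′ , |W′|≤t =
    contradiction (≤-trans (far W′) (≤-trans |W′|≤t (≤-pred 1+t≤1+R))) (<-irrefl refl)
  ball-growth W far (suc t) 1+t≤1+R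
      | no growth = ≤-trans (s≤s (ball-growth W far t (≤-trans (n≤1+n t) 1+t≤1+R))) (≰⇒> growth)

balls-packing : ∀ {n} (H : Hypergraph n) → Connected H → ∀ R (U : Subset n) → 2 ≤ ∣ U ∣ →
                (∀ u v → u ∈ U → v ∈ U → u ≢ v → DistGreater H u v R) →
                ∀ r → r + r ≤ suc R → ∣ U ∣ * r ≤ numEdges H
balls-packing {n} H connected R U 2≤∣U∣ far r 2r≤1+R =
  ≤-trans (∣p∣*r≤∑ U _ r large) (∑-count≤length U-ball (edges H) disjoint)
  where
  U-ball : Fin n → Subset n → Bool
  U-ball u e = isYes (u ∈? U) ∧ ball H u r e

  U-ball⁻ : ∀ {u e} → T (U-ball u e) → u ∈ U × T (ball H u r e)
  U-ball⁻ {u} e∈ball with Equivalence.to (T-∧ {isYes (u ∈? U)}) e∈ball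
  ... | u∈U , e∈ball′ = toWitness u∈U , e∈ball′

  large : ∀ {u} → u ∈ U → r ≤ count (U-ball u) (edges H)
  large {u} u∈U with ∃-other-member U u 2≤∣U∣
  ... | v , v∈U , v≢u = ≤-trans
    (ball-growth H (connected u v (v≢u ∘ sym)) (far u v u∈U v∈U (v≢u ∘ sym)) r
      (≤-trans (m≤m+n r r) 2r≤1+R))
    (count-mono (edges H) (λ _ → Equivalence.from T-∧ ∘ (fromWitness u∈U ,_)))

  disjoint : ∀ {e} → e ∈ₗ edges H → ∀ u v → T (U-ball u e) → T (U-ball v e) → u ≡ v
  disjoint e∈H u v e∈ballᵤ e∈ballᵥ with u ≟ v | U-ball⁻ e∈ballᵤ | U-ball⁻ e∈ballᵥ
  ... | yes u≡v | _ | _ = u≡v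
  ... | no  u≢v | u∈U , e∈Bᵤ | v∈U , e∈Bᵥ =
    ⊥-elim (balls-disjoint H {r = r} 2r≤1+R (far u v u∈U v∈U u≢v) e∈H e∈Bᵤ e∈Bᵥ)

mainTheorem10 : ∀ {n k : ℕ} (H : Hypergraph n) → Uniform k H → Connected H →
    (R : ℕ) → 1 ≤ R → (U : Subset n) → 2 ≤ ∣ U ∣ →
    (∀ u v → u ∈ U → v ∈ U → u ≢ v → DistGreater H u v R) →
    ∣ U ∣ * R ≤ 2 * numEdges H
mainTheorem10 H _ connected R _ U 2≤∣U∣ far = begin
  ∣ U ∣ * R               ≤⟨ *-monoʳ-≤ ∣ U ∣ (n≤⌈n/2⌉+⌈n/2⌉ R) ⟩
  ∣ U ∣ * (r + r)         ≡⟨ *-distribˡ-+ ∣ U ∣ r r ⟩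
  ∣ U ∣ * r + ∣ U ∣ * r   ≤⟨ +-mono-≤ ∣U∣*r≤|E| (≤-trans ∣U∣*r≤|E| (m≤m+n _ 0)) ⟩
  2 * numEdges H          ∎
  where
  open ≤-Reasoning
  r : ℕ
  r = ⌈ R /2⌉
  ∣U∣*r≤|E| : ∣ U ∣ * r ≤ numEdges H
  ∣U∣*r≤|E| = balls-packing H connected R U 2≤∣U∣ far r (⌈n/2⌉+⌈n/2⌉≤1+n R)
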